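{- There exists a connected symmetric configuration $v_3$ with strong chromatic number exactly $6$ for $v=11$ and for every $v\geq 13$.
   Context: A symmetric configuration $v_3$ is a finite incidence structure consisting of a set $V$ of $v$ points and a collection of $v$ blocks, each block a $3$-element subset of $V$, such that each point lies in exactly $3$ blocks and any two distinct points lie together in at most one block. It is connected if it is not the union of two configurations on disjoint point sets. A strong colouring assigns colours to points so that the three points of every block receive distinct colours; the strong chromatic number is the least number of colours in a strong colouring. -}

module Defs where

open import Data.Nat using (ℕ; _<_)
open import Data.Fin using (Fin)
open import Data.Fin.Properties using (_≟_)
open import Data.Bool using (Bool)
open import Data.List using (length; filter)
open import Data.List.Base using (allFin)
open import Data.Product using (Σ; ∃; _×_; _,_; proj₁)
open import Relation.Nullary using (¬_)
open import Data.Fin.Properties using (any?)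
open import Relation.Binary.PropositionalEquality using (_≡_; _≢_)

Block : ℕ → Set
Block v = Σ (Fin 3 → Fin v) (λ f → ∀ i j → f i ≡ f j → i ≡ j)

_∈B_ : ∀ {v} → Fin v → Block v → Set
p ∈B b = ∃ λ i → proj₁ b i ≡ p

blocksThrough : ∀ {v} → (Fin v → Block v) → Fin v → ℕ
blocksThrough {v} B p =
  length (filter (λ b → any? (λ i → proj₁ (B b) i ≟ p)) (allFin v))

record Config (v : ℕ) : Set where
  field
    block       : Fin v → Block v
    threeBlocks : ∀ p → blocksThrough block p ≡ 3
    atMostOne   : ∀ p q → p ≢ q → ∀ b c →
                  p ∈B block b → q ∈B block b →
                  p ∈B block c → q ∈B block c → b ≡ c
open Config public

-- Connected: not a union of two configurations on disjoint point sets, i.e.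
-- every 2-partition of the points that no block crosses is trivial.
Connected : ∀ {v} → Config v → Set
Connected {v} C = (S : Fin v → Bool) →
  (∀ b p q → p ∈B block C b → q ∈B block C b → S p ≡ S q) →
  ∀ p q → S p ≡ S q

StrongColouring : ∀ {v} → Config v → ℕ → Set
StrongColouring {v} C k = Σ (Fin v → Fin k) λ col →
  ∀ b p q → p ∈B block C b → q ∈B block C b → p ≢ q → col p ≢ col q

StrongChromaticNumber≡ : ∀ {v} → Config v → ℕ → Set
StrongChromaticNumber≡ C n = StrongColouring C n × (∀ k → k < n → ¬ StrongColouring C k)

-- For v ≥ 13 the configurations all contain the seven blocks {0,1,2}, {0,3,4}, {1,3,5}, {2,4,5},
-- {0,5,6}, {1,4,7}, {2,3,8}, in which the points 0, …, 5 are pairwise collinear, so a strong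
-- colouring needs six colours; an explicit colouring shows that six suffice.  For v ≤ 18 the
-- configurations are given by tables.  For v = 19 + m, sixteen fixed blocks (the gadget) are
-- completed by a chain of blocks {13 + i, 14 + i, 16 + i} whose last three points are tied
-- back into the gadget, and the chain is coloured with period 4.  The configuration on 11
-- points has no six pairwise collinear points; there a backtracking search shows that five
-- colours do not suffice.
--
-- A table of v triples is a configuration as soon as every point lies on three of them that
-- pairwise meet only in that point: counting the 3v incidences shows that these are then all
-- the blocks through the point.
module Submission where

open import Defs
open import Data.Bool using (Bool; true; false; T; not; _∧_; _∨_; if_then_else_)
open import Data.Bool.ListAction using (all; any)
open import Data.Bool.Properties using (T-∧; T-∨)
open import Data.Empty using (⊥-elim)
open import Data.Fin using (Fin; zero; suc; toℕ; fromℕ<)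
open import Data.Fin.Properties
  using (_≟_; any?; suc-injective; toℕ-injective; toℕ<n; toℕ-fromℕ<; fromℕ<-injective; pigeonhole)
  renaming (<⇒≢ to <⇒≢ᶠ)
open import Data.List
  using (List; []; _∷_; _++_; length; filter; filterᵇ; tabulate; allFin; upTo; map)
open import Data.List.Membership.Propositional using (lose)
open import Data.List.Membership.Propositional.Properties using (∈-allFin; ∈-upTo⁺)
open import Data.List.Relation.Unary.All as All using ()
open import Data.List.Relation.Unary.All.Properties using (all⁺)
open import Data.List.Relation.Unary.Any as Any using (satisfied)
open import Data.List.Relation.Unary.Any.Properties using (any⁺; any⁻)
open import Data.Nat
  using (ℕ; zero; suc; _+_; _∸_; _≤_; _<_; z≤n; s≤s; _≡ᵇ_; _<ᵇ_; _≤ᵇ_; _<?_)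
open import Data.Nat.Properties
  using ( +-0-commutativeMonoid; +-suc; +-identityʳ; +-cancelˡ-≡; +-cancelʳ-≤; +-cancelʳ-<; +-mono-≤
        ; +-monoʳ-≤; +-monoˡ-<; ≤-reflexive; ≤-antisym; ≤-refl; ≤-trans; ≤-pred; <-≤-trans; <-trans
        ; <-irrefl; <⇒≢; <⇒≱; ≮⇒≥; n≢0⇒n>0; m≤m+n; m+[n∸m]≡n; m∸n+n≡m; ∸-monoˡ-<
        ; ≡ᵇ⇒≡; <ᵇ⇒<; ≤ᵇ⇒≤ )
open import Algebra.Properties.CommutativeMonoid.Sum +-0-commutativeMonoid
  using (sum; ∑-comm; sum-cong-≗; sum-replicate-zero)
open import Data.Product using (Σ; ∃; _×_; _,_; proj₁; proj₂)
open import Data.Sum using (_⊎_; inj₁; inj₂)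
open import Data.Unit using (⊤; tt)
open import Function using (_∘_; case_of_; Equivalence)
open import Function.Definitions using (Injective)
open import Relation.Binary.PropositionalEquality
  using (_≡_; _≢_; ≢-sym; refl; sym; trans; cong; subst; module ≡-Reasoning)
open import Relation.Nullary using (¬_; yes; no; does)
open import Relation.Nullary.Decidable using (dec-true; dec-false)
open import Relation.Unary using (Pred; Decidable)

⟨_,_,_⟩ : ∀ {a} {A : Set a} → A → A → A → Fin 3 → A
⟨ a , b , c ⟩ zero = a
⟨ a , b , c ⟩ (suc zero) = b
⟨ a , b , c ⟩ (suc (suc zero)) = c

nth : ∀ {a} {A : Set a} → A → List A → ℕ → A
nth d [] _ = d
nth d (a ∷ as) zero = a
nth d (a ∷ as) (suc n) = nth d as n

injective-if-pairwise-≢ : ∀ {a n} {A : Set a} (f : Fin n → A) →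
  (∀ {i j} → i ≢ j → f i ≢ f j) → Injective _≡_ _≡_ f
injective-if-pairwise-≢ f f≢ {i} {j} e with i ≟ j
... | yes i≡j = i≡j
... | no i≢j = ⊥-elim (f≢ i≢j e)

pairwise-≢-on-Fin3 : ∀ {a} {A : Set a} (f : Fin 3 → A) →
  f zero ≢ f (suc zero) → f zero ≢ f (suc (suc zero)) → f (suc zero) ≢ f (suc (suc zero)) →
  ∀ {i j} → i ≢ j → f i ≢ f j
pairwise-≢-on-Fin3 f f₀≢f₁ f₀≢f₂ f₁≢f₂ {zero} {zero} i≢j = ⊥-elim (i≢j refl)
pairwise-≢-on-Fin3 f f₀≢f₁ f₀≢f₂ f₁≢f₂ {zero} {suc zero} _ = f₀≢f₁
pairwise-≢-on-Fin3 f f₀≢f₁ f₀≢f₂ f₁≢f₂ {zero} {suc (suc zero)} _ = f₀≢f₂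
pairwise-≢-on-Fin3 f f₀≢f₁ f₀≢f₂ f₁≢f₂ {suc zero} {zero} _ = ≢-sym f₀≢f₁
pairwise-≢-on-Fin3 f f₀≢f₁ f₀≢f₂ f₁≢f₂ {suc zero} {suc zero} i≢j = ⊥-elim (i≢j refl)
pairwise-≢-on-Fin3 f f₀≢f₁ f₀≢f₂ f₁≢f₂ {suc zero} {suc (suc zero)} _ = f₁≢f₂
pairwise-≢-on-Fin3 f f₀≢f₁ f₀≢f₂ f₁≢f₂ {suc (suc zero)} {zero} _ = ≢-sym f₀≢f₂
pairwise-≢-on-Fin3 f f₀≢f₁ f₀≢f₂ f₁≢f₂ {suc (suc zero)} {suc zero} _ = ≢-sym f₁≢f₂
pairwise-≢-on-Fin3 f f₀≢f₁ f₀≢f₂ f₁≢f₂ {suc (suc zero)} {suc (suc zero)} i≢j =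
  ⊥-elim (i≢j refl)

every : ∀ {n} → (Fin n → Bool) → Bool
every f = all f (allFin _)

every-sound : ∀ {n} (f : Fin n → Bool) → T (every f) → ∀ i → T (f i)
every-sound f h i = All.lookup (all⁺ f (allFin _) h) (∈-allFin i)

every² : ∀ {m n} → (Fin m → Fin n → Bool) → Bool
every² f = every λ i → every λ j → f i j

every²-sound : ∀ {m n} (f : Fin m → Fin n → Bool) → T (every² f) → ∀ i j → T (f i j)
every²-sound f h i j = every-sound (f i) (every-sound (λ i → every (f i)) h i) j

everyPair : ∀ {n} → (Fin n → Fin n → Bool) → Bool
everyPair f = every² λ i j → does (i ≟ j) ∨ f i j

everyPair-sound : ∀ {n} (f : Fin n → Fin n → Bool) → T (everyPair f) → ∀ {i j} → i ≢ j → T (f i j)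
everyPair-sound f h {i} {j} i≢j with i ≟ j | every²-sound _ h i j
... | yes i≡j | _ = ⊥-elim (i≢j i≡j)
... | no _ | fij = fij

some : ∀ {n} → (Fin n → Bool) → Bool
some f = any f (allFin _)

any-sound : ∀ {a} {A : Set a} (f : A → Bool) xs → T (any f xs) → ∃ λ x → T (f x)
any-sound f xs h = satisfied (any⁻ f xs h)

everyBelow : ℕ → (ℕ → Bool) → Bool
everyBelow n f = all f (upTo n)

everyBelow-sound : ∀ {n} (f : ℕ → Bool) → T (everyBelow n f) → ∀ {l} → l < n → T (f l)
everyBelow-sound {n} f h l<n = All.lookup (all⁺ f (upTo n) h) (∈-upTo⁺ l<n)

∧-split : ∀ a b → T (a ∧ b) → T a × T b
∧-split a b = Equivalence.to T-∧

¬T⇒T-not : ∀ {b} → ¬ T b → T (not b)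
¬T⇒T-not {true} ¬b = ¬b tt
¬T⇒T-not {false} _ = tt

T-not⇒¬T : ∀ {b} → T (not b) → ¬ T b
T-not⇒¬T {false} _ ()

-- Double counting

𝟙 : Bool → ℕ
𝟙 true = 1
𝟙 false = 0

count : ∀ {n} → (Fin n → Bool) → ℕ
count f = sum (λ i → 𝟙 (f i))

length-filter-tabulate : ∀ {a p n} {A : Set a} {P : Pred A p} (P? : Decidable P)
  (f : Fin n → A) → length (filter P? (tabulate f)) ≡ count (λ i → does (P? (f i)))
length-filter-tabulate {n = zero} P? f = refl
length-filter-tabulate {n = suc n} P? f with does (P? (f zero))
... | true = cong suc (length-filter-tabulate P? (f ∘ suc))
... | false = length-filter-tabulate P? (f ∘ suc)

without : ∀ {n} → (Fin n → Bool) → Fin n → Fin n → Bool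
without f i j = if does (j ≟ i) then false else f j

without-≢ : ∀ {n} (f : Fin n → Bool) {i j} → j ≢ i → without f i j ≡ f j
without-≢ f {i} {j} j≢i rewrite dec-false (j ≟ i) j≢i = refl

count-without : ∀ {n} (f : Fin n → Bool) i → f i ≡ true → count f ≡ suc (count (without f i))
count-without f zero fi rewrite fi = refl
count-without {suc n} f (suc i) fi =
  trans (cong (𝟙 (f zero) +_) (count-without (f ∘ suc) i fi)) (+-suc (𝟙 (f zero)) _)

injection⇒≤count : ∀ {k n} (f : Fin n → Bool) (t : Fin k → Fin n) → Injective _≡_ _≡_ t →
  (∀ j → f (t j) ≡ true) → k ≤ count f
injection⇒≤count {zero} f t t-injective ft = z≤n
injection⇒≤count {suc k} f t t-injective ft =
  subst (suc k ≤_) (sym (count-without f (t zero) (ft zero)))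
    (s≤s (injection⇒≤count (without f (t zero)) (t ∘ suc) (suc-injective ∘ t-injective) f-rest))
  where
  f-rest : ∀ j → without f (t zero) (t (suc j)) ≡ true
  f-rest j = trans (without-≢ f (λ e → case t-injective e of λ ())) (ft (suc j))

count-point : ∀ {n} (q : Fin n) → count (λ p → does (q ≟ p)) ≡ 1
count-point {suc n} zero = cong suc (sum-replicate-zero n)
count-point (suc q) = count-point q

any≤count : ∀ {n p} {P : Pred (Fin n) p} (P? : Decidable P) →
  𝟙 (does (any? P?)) ≤ count (does ∘ P?)
any≤count {zero} P? = z≤n
any≤count {suc n} P? with does (P? zero)
... | true = s≤s z≤n
... | false = any≤count (P? ∘ suc)

sum-mono-≤ : ∀ {n} {f g : Fin n → ℕ} → (∀ i → f i ≤ g i) → sum f ≤ sum g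
sum-mono-≤ {zero} f≤g = z≤n
sum-mono-≤ {suc n} f≤g = +-mono-≤ (f≤g zero) (sum-mono-≤ (f≤g ∘ suc))

+-≡⇒≡ : ∀ {a b c d} → a ≤ c → b ≤ d → a + b ≡ c + d → a ≡ c × b ≡ d
+-≡⇒≡ {a} {b} {c} {d} a≤c b≤d eq = a≡c , +-cancelˡ-≡ a b d (trans eq (cong (_+ d) (sym a≡c)))
  where
  a≡c : a ≡ c
  a≡c = ≤-antisym a≤c (+-cancelʳ-≤ b c a (≤-trans (+-monoʳ-≤ c b≤d) (≤-reflexive (sym eq))))

sum-≡⇒≗ : ∀ {n} {f g : Fin n → ℕ} → (∀ i → f i ≤ g i) → sum f ≡ sum g → ∀ i → f i ≡ g i
sum-≡⇒≗ f≤g eq zero = proj₁ (+-≡⇒≡ (f≤g zero) (sum-mono-≤ (f≤g ∘ suc)) eq)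
sum-≡⇒≗ f≤g eq (suc i) =
  sum-≡⇒≗ (f≤g ∘ suc) (proj₂ (+-≡⇒≡ (f≤g zero) (sum-mono-≤ (f≤g ∘ suc)) eq)) i

module _ {v} (B : Fin v → Block v) where

  incidences : Fin v → ℕ
  incidences p = sum (λ b → count (λ i → does (proj₁ (B b) i ≟ p)))

  sum-incidences : sum incidences ≡ sum (λ (_ : Fin v) → 3)
  sum-incidences = begin
    sum (λ p → sum (λ b → sum (λ i → 𝟙 (does (proj₁ (B b) i ≟ p)))))
      ≡⟨ ∑-comm (λ p b → sum (λ i → 𝟙 (does (proj₁ (B b) i ≟ p)))) ⟩
    sum (λ b → sum (λ p → sum (λ i → 𝟙 (does (proj₁ (B b) i ≟ p)))))
      ≡⟨ sum-cong-≗ (λ b → ∑-comm (λ p i → 𝟙 (does (proj₁ (B b) i ≟ p)))) ⟩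
    sum (λ b → sum (λ i → count (λ p → does (proj₁ (B b) i ≟ p))))
      ≡⟨ sum-cong-≗ (λ b → sum-cong-≗ (λ i → count-point (proj₁ (B b) i))) ⟩
    sum (λ (b : Fin v) → sum (λ (i : Fin 3) → 1)) ∎
    where open ≡-Reasoning

  blocksThrough≡count : ∀ p →
    blocksThrough B p ≡ count (λ b → does (any? (λ i → proj₁ (B b) i ≟ p)))
  blocksThrough≡count p = length-filter-tabulate (λ b → any? (λ i → proj₁ (B b) i ≟ p)) (λ b → b)

  blocksThrough≤incidences : ∀ p → blocksThrough B p ≤ incidences p
  blocksThrough≤incidences p = subst (_≤ incidences p) (sym (blocksThrough≡count p))
    (sum-mono-≤ (λ b → any≤count (λ i → proj₁ (B b) i ≟ p)))

  three-blocks : (∀ p → 3 ≤ blocksThrough B p) → ∀ p → blocksThrough B p ≡ 3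
  three-blocks 3≤ p = ≤-antisym
    (subst (blocksThrough B p ≤_) (sym (3≡incidences p)) (blocksThrough≤incidences p)) (3≤ p)
    where
    3≡incidences : ∀ p → 3 ≡ incidences p
    3≡incidences =
      sum-≡⇒≗ (λ p → ≤-trans (3≤ p) (blocksThrough≤incidences p)) (sym sum-incidences)

  injection⇒≤blocksThrough : ∀ {k} p (t : Fin k → Fin v) → Injective _≡_ _≡_ t →
    (∀ j → p ∈B B (t j)) → k ≤ blocksThrough B p
  injection⇒≤blocksThrough {k} p t t-injective p∈t = subst (k ≤_) (sym (blocksThrough≡count p))
    (injection⇒≤count _ t t-injective λ j → dec-true (any? (λ i → proj₁ (B (t j)) i ≟ p)) (p∈t j))

record Star {v} (B : Fin v → Block v) (p : Fin v) : Set where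
  field
    through : Fin 3 → Fin v
    through-injective : Injective _≡_ _≡_ through
    on-through : ∀ k → p ∈B B (through k)
    meet-only-at : ∀ {k k′} → k ≢ k′ → ∀ {q} →
                   q ∈B B (through k) → q ∈B B (through k′) → q ≡ p

module _ {v} (B : Fin v → Block v) (star : ∀ p → Star B p) where
  open Star

  blocksThrough≡3 : ∀ p → blocksThrough B p ≡ 3
  blocksThrough≡3 = three-blocks B (λ p →
    injection⇒≤blocksThrough B p (through (star p)) (through-injective (star p)) (on-through (star p)))

  through-complete : ∀ p b → p ∈B B b → ∃ λ k → b ≡ through (star p) k
  through-complete p b p∈b with any? (λ k → b ≟ through (star p) k)
  ... | yes found = found
  ... | no missing = ⊥-elim (<-irrefl (sym (blocksThrough≡3 p))
                               (injection⇒≤blocksThrough B p t t-injective p∈t))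
    where
    t : Fin 4 → Fin v
    t zero = b
    t (suc k) = through (star p) k
    t-injective : Injective _≡_ _≡_ t
    t-injective {zero} {zero} _ = refl
    t-injective {zero} {suc k} e = ⊥-elim (missing (k , e))
    t-injective {suc k} {zero} e = ⊥-elim (missing (k , sym e))
    t-injective {suc k} {suc k′} e = cong suc (through-injective (star p) e)
    p∈t : ∀ j → p ∈B B (t j)
    p∈t zero = p∈b
    p∈t (suc k) = on-through (star p) k

  config-from-stars : Config v
  config-from-stars =
    record { block = B ; threeBlocks = blocksThrough≡3 ; atMostOne = at-most-one }
    where
    at-most-one : ∀ p q → p ≢ q → ∀ b c → p ∈B B b → q ∈B B b → p ∈B B c → q ∈B B c → b ≡ c
    at-most-one p q p≢q b c p∈b q∈b p∈c q∈c
      with through-complete p b p∈b | through-complete p c p∈c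
    ... | k , refl | k′ , refl with k ≟ k′
    ...   | yes refl = refl
    ...   | no k≢k′ = ⊥-elim (p≢q (sym (meet-only-at (star p) k≢k′ q∈b q∈c)))

-- Connectivity and colourings

Collinear : ∀ {v} → Config v → Fin v → Fin v → Set
Collinear C p q = ∃ λ b → p ∈B block C b × q ∈B block C b

connected-by-descent : ∀ {v} (C : Config v) (rank : Fin v → ℕ) (root : Fin v) →
  (∀ p → p ≢ root → ∃ λ q → rank q < rank p × Collinear C p q) → Connected C
connected-by-descent C rank root descend S S-on-blocks p q = trans (reach p) (sym (reach q))
  where
  reach-below : ∀ n p → rank p < n → S p ≡ S root
  reach-below (suc n) p rp<sn with p ≟ root
  ... | yes refl = refl
  ... | no p≢root with descend p p≢root
  ...   | q , rq<rp , b , p∈b , q∈b =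
          trans (S-on-blocks b p q p∈b q∈b) (reach-below n q (<-≤-trans rq<rp (≤-pred rp<sn)))
  reach : ∀ p → S p ≡ S root
  reach p = reach-below (suc (rank p)) p ≤-refl

colouring-injective-on-blocks : ∀ {v k} (C : Config v) (col : Fin v → Fin k) →
  (∀ b → Injective _≡_ _≡_ (col ∘ proj₁ (block C b))) → StrongColouring C k
colouring-injective-on-blocks C col injective = col ,
  λ { b p q (i , refl) (j , refl) p≢q same → p≢q (cong (proj₁ (block C b)) (injective b same)) }

clique⇒¬colouring : ∀ {v n k} (C : Config v) (x : Fin n → Fin v) → Injective _≡_ _≡_ x →
  (∀ {a b} → a ≢ b → Collinear C (x a) (x b)) → k < n → ¬ StrongColouring C k
clique⇒¬colouring C x x-injective collinear k<n (col , proper) with pigeonhole k<n (col ∘ x)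
... | a , b , a<b , same with collinear (<⇒≢ᶠ a<b)
...   | l , xa∈l , xb∈l = proper l (x a) (x b) xa∈l xb∈l (<⇒≢ᶠ a<b ∘ x-injective) same

module Backtracking (adjacent : ℕ → ℕ → Bool) where
  clashes : ℕ → ℕ → List (ℕ × ℕ) → Bool
  clashes p c [] = false
  clashes p c ((q , d) ∷ σ) = ((c ≡ᵇ d) ∧ adjacent p q) ∨ clashes p c σ

  extendable : ℕ → List (ℕ × ℕ) → List ℕ → Bool
  extendable n σ [] = true
  extendable n σ (p ∷ ps) =
    any (λ c → not (clashes p c σ) ∧ extendable n ((p , c) ∷ σ) ps) (upTo n)

  module _ {n} (κ : ℕ → ℕ) (κ<n : ∀ p → κ p < n)
           (proper : ∀ {p q} → T (adjacent p q) → κ p ≢ κ q) where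
    Agrees : List (ℕ × ℕ) → Set
    Agrees [] = ⊤
    Agrees ((q , d) ∷ σ) = d ≡ κ q × Agrees σ

    no-clash : ∀ p σ → Agrees σ → ¬ T (clashes p (κ p) σ)
    no-clash p [] _ ()
    no-clash p ((q , d) ∷ σ) (refl , agrees) h with Equivalence.to T-∨ h
    ... | inj₂ later = no-clash p σ agrees later
    ... | inj₁ now with ∧-split (κ p ≡ᵇ κ q) (adjacent p q) now
    ...   | same-colour , adj = proper adj (≡ᵇ⇒≡ _ _ same-colour)

    colouring⇒extendable : ∀ σ ps → Agrees σ → T (extendable n σ ps)
    colouring⇒extendable σ [] agrees = tt
    colouring⇒extendable σ (p ∷ ps) agrees =
      any⁺ _ (lose (∈-upTo⁺ (κ<n p)) (Equivalence.from T-∧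
        (¬T⇒T-not (no-clash p σ agrees) , colouring⇒extendable ((p , κ p) ∷ σ) ps (refl , agrees))))

On : (ℕ → Fin 3 → ℕ) → ℕ → ℕ → Set
On line l p = ∃ λ i → line l i ≡ p

record Table (v : ℕ) : Set where
  field
    line : ℕ → Fin 3 → ℕ
    line< : ∀ {l} → l < v → ∀ i → line l i < v
    line-injective : ∀ {l} → l < v → ∀ {i j} → line l i ≡ line l j → i ≡ j

record StarAt (line : ℕ → Fin 3 → ℕ) (v p : ℕ) : Set where
  field
    through : Fin 3 → ℕ
    through< : ∀ k → through k < v
    through-injective : Injective _≡_ _≡_ through
    on-through : ∀ k → On line (through k) p
    meet-only-at : ∀ {k k′} → k ≢ k′ → ∀ {q} →
                   On line (through k) q → On line (through k′) q → q ≡ p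

HasParent : (ℕ → Fin 3 → ℕ) → ℕ → ℕ → Set
HasParent line v p = ∃ λ q → q < p × ∃ λ l → l < v × On line l p × On line l q

module FromTable {v} (𝒯 : Table v) where
  open Table 𝒯

  blocks : Fin v → Block v
  blocks b = (λ i → fromℕ< (line< (toℕ<n b) i)) , λ i j e →
    line-injective (toℕ<n b) (fromℕ<-injective _ _ (line< (toℕ<n b) i) (line< (toℕ<n b) j) e)

  toℕ-blocks : ∀ b i → toℕ (proj₁ (blocks b) i) ≡ line (toℕ b) i
  toℕ-blocks b i = toℕ-fromℕ< (line< (toℕ<n b) i)

  On⇒∈ : ∀ {p l} (l<v : l < v) → On line l (toℕ p) → p ∈B blocks (fromℕ< l<v)
  On⇒∈ {p} {l} l<v (i , e) = i , toℕ-injective (begin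
    toℕ (proj₁ (blocks (fromℕ< l<v)) i) ≡⟨ toℕ-blocks (fromℕ< l<v) i ⟩
    line (toℕ (fromℕ< l<v)) i           ≡⟨ cong (λ l′ → line l′ i) (toℕ-fromℕ< l<v) ⟩
    line l i                            ≡⟨ e ⟩
    toℕ p                               ∎)
    where open ≡-Reasoning

  ∈⇒On : ∀ {p l} (l<v : l < v) → p ∈B blocks (fromℕ< l<v) → On line l (toℕ p)
  ∈⇒On l<v (i , refl) = i , trans (cong (λ l′ → line l′ i) (sym (toℕ-fromℕ< l<v))) (sym (toℕ-blocks _ i))

  star : ∀ {p} → StarAt line v (toℕ p) → Star blocks p
  star s = record
    { through = λ k → fromℕ< (through< k)
    ; through-injective = λ e → through-injective (fromℕ<-injective _ _ (through< _) (through< _) e)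
    ; on-through = λ k → On⇒∈ (through< k) (on-through k)
    ; meet-only-at = λ k≢k′ q∈ q∈′ →
        toℕ-injective (meet-only-at k≢k′ (∈⇒On (through< _) q∈) (∈⇒On (through< _) q∈′))
    }
    where open StarAt s

  module _ (stars : ∀ {p} → p < v → StarAt line v p) where
    C : Config v
    C = config-from-stars blocks (λ p → star (stars (toℕ<n p)))

    collinear : ∀ {p q l} → l < v → On line l (toℕ p) → On line l (toℕ q) → Collinear C p q
    collinear l<v p∈l q∈l = fromℕ< l<v , On⇒∈ l<v p∈l , On⇒∈ l<v q∈l

    connected : (∀ {p} → p < v → 0 < p → HasParent line v p) → Connected C
    connected parent S S-on-blocks p = connected-by-descent C toℕ root descend S S-on-blocks p
      where
      root : Fin v
      root = fromℕ< (≤-trans (s≤s z≤n) (toℕ<n p))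
      descend : ∀ r → r ≢ root → ∃ λ q → toℕ q < toℕ r × Collinear C r q
      descend r r≢root
        with parent (toℕ<n r) (n≢0⇒n>0 (λ r≡0 → r≢root (toℕ-injective (trans r≡0 (sym (toℕ-fromℕ< _))))))
      ... | q , q<r , l , l<v , r∈l , q∈l =
        fromℕ< q<v , subst (_< toℕ r) (sym (toℕ-fromℕ< q<v)) q<r ,
        collinear l<v r∈l (subst (On line l) (sym (toℕ-fromℕ< q<v)) q∈l)
        where
        q<v : q < v
        q<v = <-trans q<r (toℕ<n r)

    strong-colouring : ∀ {k} (col : ℕ → ℕ) → (∀ {p} → p < v → col p < k) →
      (∀ {l} → l < v → ∀ {i j} → col (line l i) ≡ col (line l j) → i ≡ j) → StrongColouring C k
    strong-colouring col col< proper =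
      colouring-injective-on-blocks C (λ p → fromℕ< (col< (toℕ<n p))) injective
      where
      injective : ∀ b → Injective _≡_ _≡_ (λ i → fromℕ< (col< (toℕ<n (proj₁ (blocks b) i))))
      injective b {i} {j} e = proper (toℕ<n b) (begin
        col (line (toℕ b) i)            ≡⟨ cong col (sym (toℕ-blocks b i)) ⟩
        col (toℕ (proj₁ (blocks b) i))  ≡⟨ fromℕ<-injective _ _ (col< (toℕ<n _)) (col< (toℕ<n _)) e ⟩
        col (toℕ (proj₁ (blocks b) j))  ≡⟨ cong col (toℕ-blocks b j) ⟩
        col (line (toℕ b) j)            ∎)
        where open ≡-Reasoning

    clique⇒¬colouringᵗ : ∀ {n k} (x : Fin n → ℕ) (x< : ∀ a → x a < v) → Injective _≡_ _≡_ x →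
      (∀ {a b} → a ≢ b → ∃ λ l → l < v × On line l (x a) × On line l (x b)) →
      k < n → ¬ StrongColouring C k
    clique⇒¬colouringᵗ x x< x-injective pairs = clique⇒¬colouring C (λ a → fromℕ< (x< a))
      (λ e → x-injective (fromℕ<-injective _ _ (x< _) (x< _) e)) collinear′
      where
      collinear′ : ∀ {a b} → a ≢ b → Collinear C (fromℕ< (x< a)) (fromℕ< (x< b))
      collinear′ {a} {b} a≢b with pairs a≢b
      ... | l , l<v , a∈l , b∈l = collinear l<v (subst (On line l) (sym (toℕ-fromℕ< (x< a))) a∈l)
                                               (subst (On line l) (sym (toℕ-fromℕ< (x< b))) b∈l)

    module _ {k} (colouring : StrongColouring C k) where
      private
        col : Fin v → Fin k
        col = proj₁ colouring

      colourℕ : ℕ → ℕ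
      colourℕ p with p <? v
      ... | yes p<v = toℕ (col (fromℕ< p<v))
      ... | no _ = 0

      colourℕ-at : ∀ {p} (p<v : p < v) → colourℕ p ≡ toℕ (col (fromℕ< p<v))
      colourℕ-at {p} p<v with p <? v
      ... | yes _ = refl
      ... | no p≮v = ⊥-elim (p≮v p<v)

      colourℕ< : ∀ {n} → k ≤ n → 0 < n → ∀ p → colourℕ p < n
      colourℕ< k≤n 0<n p with p <? v
      ... | yes p<v = <-≤-trans (toℕ<n (col (fromℕ< p<v))) k≤n
      ... | no _ = 0<n

      colourℕ-proper : ∀ {p q l} → l < v → On line l p → On line l q → p ≢ q → colourℕ p ≢ colourℕ q
      colourℕ-proper {p} {q} {l} l<v p∈l q∈l p≢q same =
        proj₂ colouring (fromℕ< l<v) (fromℕ< p<v) (fromℕ< q<v)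
          (On⇒∈ l<v (subst (On line l) (sym (toℕ-fromℕ< p<v)) p∈l))
          (On⇒∈ l<v (subst (On line l) (sym (toℕ-fromℕ< q<v)) q∈l))
          (p≢q ∘ fromℕ<-injective _ _ p<v q<v)
          (toℕ-injective (trans (sym (colourℕ-at p<v)) (trans same (colourℕ-at q<v))))
        where
        p<v : p < v
        p<v = subst (_< v) (proj₂ p∈l) (line< l<v (proj₁ p∈l))
        q<v : q < v
        q<v = subst (_< v) (proj₂ q∈l) (line< l<v (proj₁ q∈l))

record Certificate {v} (𝒯 : Table v) : Set where
  field
    star : ∀ {p} → p < v → StarAt (Table.line 𝒯) v p
    parent : ∀ {p} → p < v → 0 < p → HasParent (Table.line 𝒯) v p
    colour : ℕ → ℕ
    colour<6 : ∀ {p} → p < v → colour p < 6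
    colour-proper : ∀ {l} → l < v → ∀ {i j} →
                    colour (Table.line 𝒯 l i) ≡ colour (Table.line 𝒯 l j) → i ≡ j

SixChromatic : ℕ → Set
SixChromatic v = Σ (Config v) (λ C → Connected C × StrongChromaticNumber≡ C 6)

module Certified {v} {𝒯 : Table v} (cert : Certificate 𝒯) where
  open Table 𝒯
  open Certificate cert
  open FromTable 𝒯
    using (C; connected; strong-colouring; clique⇒¬colouringᵗ; colourℕ; colourℕ<; colourℕ-proper)

  C-colouring : StrongColouring (C star) 6
  C-colouring = strong-colouring star colour colour<6 colour-proper

  six-chromatic-by-clique : 6 ≤ v →
    (∀ {a b : Fin 6} → a ≢ b → ∃ λ l → l < v × On line l (toℕ a) × On line l (toℕ b)) → SixChromatic v
  six-chromatic-by-clique 6≤v clique = C star , connected star parent , C-colouring ,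
    λ k → clique⇒¬colouringᵗ star toℕ (λ a → <-≤-trans (toℕ<n a) 6≤v) toℕ-injective clique

  six-chromatic-by-search : (adjacent : ℕ → ℕ → Bool) →
    (∀ {p q} → T (adjacent p q) → p ≢ q × ∃ λ l → l < v × On line l p × On line l q) →
    (order : List ℕ) → T (not (Backtracking.extendable adjacent 5 [] order)) → SixChromatic v
  six-chromatic-by-search adjacent adjacent-sound order stuck =
    C star , connected star parent , C-colouring , λ k k<6 c → T-not⇒¬T stuck
      (Backtracking.colouring⇒extendable adjacent (colourℕ star c) (colourℕ< star c (≤-pred k<6) (s≤s z≤n))
        (proper c) [] order tt)
    where
    proper : ∀ {k} (c : StrongColouring (C star) k) {p q} → T (adjacent p q) →
      colourℕ star c p ≢ colourℕ star c q
    proper c adj with adjacent-sound adj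
    ... | p≢q , l , l<v , p∈l , q∈l = colourℕ-proper star c l<v p∈l q∈l p≢q

-- The numbers c and c + x for a parameter x.  Comparisons between them that hold for
-- every x are decided on the symbols, so one computation checks a whole family.
data Expr : Set where
  fixed shifted : ℕ → Expr

⟦_⟧ : Expr → ℕ → ℕ
⟦ fixed c ⟧ x = c
⟦ shifted c ⟧ x = c + x

offset : Expr → ℕ
offset (fixed c) = c
offset (shifted c) = c

below : Expr → Expr → Bool
below (fixed a) (fixed b) = a <ᵇ b
below (fixed a) (shifted b) = a <ᵇ b
below (shifted a) (fixed b) = false
below (shifted a) (shifted b) = a <ᵇ b

below-sound : ∀ e e′ x → T (below e e′) → ⟦ e ⟧ x < ⟦ e′ ⟧ x
below-sound (fixed a) (fixed b) x h = <ᵇ⇒< a b h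
below-sound (fixed a) (shifted b) x h = <-≤-trans (<ᵇ⇒< a b h) (m≤m+n b x)
below-sound (shifted a) (shifted b) x h = +-monoˡ-< x (<ᵇ⇒< a b h)

apart : Expr → Expr → Bool
apart e e′ = below e e′ ∨ below e′ e

apart-sound : ∀ e e′ x → T (apart e e′) → ⟦ e ⟧ x ≢ ⟦ e′ ⟧ x
apart-sound e e′ x h with Equivalence.to T-∨ h
... | inj₁ e<e′ = <⇒≢ (below-sound e e′ x e<e′)
... | inj₂ e′<e = ≢-sym (<⇒≢ (below-sound e′ e x e′<e))

same : Expr → Expr → Bool
same (fixed a) (fixed b) = a ≡ᵇ b
same (shifted a) (shifted b) = a ≡ᵇ b
same _ _ = false

same-sound : ∀ e e′ x → T (same e e′) → ⟦ e ⟧ x ≡ ⟦ e′ ⟧ x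
same-sound (fixed a) (fixed b) x h = ≡ᵇ⇒≡ a b h
same-sound (shifted a) (shifted b) x h = cong (_+ x) (≡ᵇ⇒≡ a b h)

record Reading (line : ℕ → Fin 3 → ℕ) (v : ℕ) : Set where
  field
    x bound : ℕ
    bound+x≤v : bound + x ≤ v
    content : Expr → Fin 3 → Expr
    faithful : Expr → Bool
    faithful-sound : ∀ l → T (faithful l) → ∀ i → line (⟦ l ⟧ x) i ≡ ⟦ content l i ⟧ x

module Checks {line v} (R : Reading line v) where
  open Reading R

  inRange : Expr → Bool
  inRange e = offset e <ᵇ bound

  inRange-sound : ∀ e → T (inRange e) → ⟦ e ⟧ x < v
  inRange-sound (fixed c) h = <-≤-trans (<ᵇ⇒< c bound h) (≤-trans (m≤m+n bound x) bound+x≤v)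
  inRange-sound (shifted c) h = <-≤-trans (+-monoˡ-< x (<ᵇ⇒< c bound h)) bound+x≤v

  lineᵇ : Expr → Bool
  lineᵇ l = faithful l ∧ every (λ i → inRange (content l i))
                      ∧ everyPair (λ i j → apart (content l i) (content l j))

  lineᵇ-sound : ∀ l → T (lineᵇ l) →
    (∀ i → line (⟦ l ⟧ x) i < v) × (∀ {i j} → line (⟦ l ⟧ x) i ≡ line (⟦ l ⟧ x) j → i ≡ j)
  lineᵇ-sound l h with ∧-split (faithful l) _ h
  ... | faithful-l , h′ with ∧-split (every (λ i → inRange (content l i))) _ h′
  ...   | all-in-range , all-apart =
    (λ i → subst (_< v) (sym (faithful-sound l faithful-l i)) (inRange-sound (content l i)
             (every-sound (λ i → inRange (content l i)) all-in-range i))) ,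
    injective-if-pairwise-≢ _ (λ {i} {j} i≢j e → apart-sound (content l i) (content l j) x
      (everyPair-sound (λ i j → apart (content l i) (content l j)) all-apart i≢j)
      (trans (sym (faithful-sound l faithful-l i)) (trans e (faithful-sound l faithful-l j))))

  on : Expr → Expr → Bool
  on u l = faithful l ∧ inRange l ∧ some (λ i → same (content l i) u)

  on⇒faithful : ∀ u l → T (on u l) → T (faithful l)
  on⇒faithful u l h = proj₁ (∧-split (faithful l) _ h)

  on-sound : ∀ u l → T (on u l) → ⟦ l ⟧ x < v × On line (⟦ l ⟧ x) (⟦ u ⟧ x)
  on-sound u l h with ∧-split (faithful l) _ h
  ... | faithful-l , h′ with ∧-split (inRange l) _ h′
  ...   | l-in-range , found with any-sound (λ i → same (content l i) u) (allFin 3) found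
  ...     | i , same-i = inRange-sound l l-in-range ,
                         i , trans (faithful-sound l faithful-l i) (same-sound (content l i) u x same-i)

  separatedᵇ : (Fin 3 → Expr) → Expr → Fin 3 → Fin 3 → Bool
  separatedᵇ t u k k′ =
    every² λ i j → apart (content (t k) i) (content (t k′) j) ∨ same (content (t k) i) u

  starᵇ : (Fin 3 → Expr) → Expr → Bool
  starᵇ t u = every (λ k → on u (t k))
            ∧ everyPair (λ k k′ → apart (t k) (t k′))
            ∧ everyPair (separatedᵇ t u)

  starᵇ-sound : ∀ t u → T (starᵇ t u) → StarAt line v (⟦ u ⟧ x)
  starᵇ-sound t u h with ∧-split (every (λ k → on u (t k))) _ h
  ... | all-on , h′ with ∧-split (everyPair (λ k k′ → apart (t k) (t k′))) _ h′
  ...   | all-apart , all-separated = record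
    { through = λ k → ⟦ t k ⟧ x
    ; through< = λ k → proj₁ (on-sound u (t k) (u-on k))
    ; through-injective = injective-if-pairwise-≢ _ (λ {k} {k′} k≢k′ → apart-sound (t k) (t k′) x
                            (everyPair-sound (λ k k′ → apart (t k) (t k′)) all-apart k≢k′))
    ; on-through = λ k → proj₂ (on-sound u (t k) (u-on k))
    ; meet-only-at = meet
    }
    where
    u-on : ∀ k → T (on u (t k))
    u-on = every-sound (λ k → on u (t k)) all-on
    faithful-t : ∀ k i → line (⟦ t k ⟧ x) i ≡ ⟦ content (t k) i ⟧ x
    faithful-t k = faithful-sound (t k) (on⇒faithful u (t k) (u-on k))
    meet : ∀ {k k′} → k ≢ k′ → ∀ {q} → On line (⟦ t k ⟧ x) q → On line (⟦ t k′ ⟧ x) q → q ≡ ⟦ u ⟧ x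
    meet {k} {k′} k≢k′ (i , refl) (j , e) with Equivalence.to T-∨
      (every²-sound (λ i j → apart (content (t k) i) (content (t k′) j) ∨ same (content (t k) i) u)
                    (everyPair-sound (separatedᵇ t u) all-separated k≢k′) i j)
    ... | inj₁ ap = ⊥-elim (apart-sound (content (t k) i) (content (t k′) j) x ap
                      (trans (sym (faithful-t k i)) (trans (sym e) (faithful-t k′ j))))
    ... | inj₂ sm = trans (faithful-t k i) (same-sound (content (t k) i) u x sm)

  starOfᵇ : List Expr → Expr → Bool
  starOfᵇ (a ∷ b ∷ c ∷ _) u = starᵇ ⟨ a , b , c ⟩ u
  starOfᵇ _ _ = false

  starOfᵇ-sound : ∀ ls u → T (starOfᵇ ls u) → StarAt line v (⟦ u ⟧ x)
  starOfᵇ-sound (a ∷ b ∷ c ∷ _) u = starᵇ-sound ⟨ a , b , c ⟩ u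

  starAmongᵇ : List Expr → Expr → Bool
  starAmongᵇ names u = starOfᵇ (filterᵇ (on u) names) u

  starAmongᵇ-sound : ∀ names u → T (starAmongᵇ names u) → StarAt line v (⟦ u ⟧ x)
  starAmongᵇ-sound names u = starOfᵇ-sound (filterᵇ (on u) names) u

  parentᵇ : List Expr → Expr → Bool
  parentᵇ names u = any (λ l → on u l ∧ some (λ i → below (content l i) u)) names

  parentᵇ-sound : ∀ names u → T (parentᵇ names u) → HasParent line v (⟦ u ⟧ x)
  parentᵇ-sound names u h with any-sound _ names h
  ... | l , h′ with ∧-split (on u l) _ h′
  ...   | u-on-l , found with any-sound (λ i → below (content l i) u) (allFin 3) found
  ...     | i , i-below = ⟦ content l i ⟧ x , below-sound (content l i) u x i-below ,
                          ⟦ l ⟧ x , proj₁ (on-sound u l u-on-l) , proj₂ (on-sound u l u-on-l) ,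
                          i , faithful-sound l (on⇒faithful u l u-on-l) i

  collinearᵇ : List Expr → Expr → Expr → Bool
  collinearᵇ names u w = any (λ l → on u l ∧ on w l) names

  collinearᵇ-sound : ∀ names u w → T (collinearᵇ names u w) →
    ∃ λ l → l < v × On line l (⟦ u ⟧ x) × On line l (⟦ w ⟧ x)
  collinearᵇ-sound names u w h with any-sound _ names h
  ... | l , h′ with ∧-split (on u l) (on w l) h′
  ...   | u-on-l , w-on-l = ⟦ l ⟧ x , proj₁ (on-sound u l u-on-l) , proj₂ (on-sound u l u-on-l) ,
                            proj₂ (on-sound w l w-on-l)

  linesBelowᵇ : ℕ → Bool
  linesBelowᵇ n = everyBelow n (lineᵇ ∘ fixed)

  linesBelowᵇ-sound : ∀ {n} → T (linesBelowᵇ n) → ∀ {l} → l < n →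
    (∀ i → line l i < v) × (∀ {i j} → line l i ≡ line l j → i ≡ j)
  linesBelowᵇ-sound ok l<n = lineᵇ-sound (fixed _) (everyBelow-sound (lineᵇ ∘ fixed) ok l<n)

  starsBelowᵇ : List Expr → ℕ → Bool
  starsBelowᵇ names n = everyBelow n (starAmongᵇ names ∘ fixed)

  starsBelowᵇ-sound : ∀ names {n} → T (starsBelowᵇ names n) → ∀ {p} → p < n → StarAt line v p
  starsBelowᵇ-sound names ok p<n =
    starAmongᵇ-sound names (fixed _) (everyBelow-sound (starAmongᵇ names ∘ fixed) ok p<n)

  parentsBelowᵇ : List Expr → ℕ → Bool
  parentsBelowᵇ names n = everyBelow n (λ p → (p ≡ᵇ 0) ∨ parentᵇ names (fixed p))

  parentsBelowᵇ-sound : ∀ names {n} → T (parentsBelowᵇ names n) →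
    ∀ {p} → p < n → 0 < p → HasParent line v p
  parentsBelowᵇ-sound names ok {p} p<n 0<p
    with Equivalence.to T-∨ (everyBelow-sound (λ p → (p ≡ᵇ 0) ∨ parentᵇ names (fixed p)) ok p<n)
  ... | inj₁ p≡0 = ⊥-elim (<-irrefl (sym (≡ᵇ⇒≡ p 0 p≡0)) 0<p)
  ... | inj₂ found = parentᵇ-sound names (fixed p) found

  sixCliqueᵇ : List Expr → Bool
  sixCliqueᵇ names = everyPair {6} (λ a b → collinearᵇ names (fixed (toℕ a)) (fixed (toℕ b)))

  sixCliqueᵇ-sound : ∀ names → T (sixCliqueᵇ names) →
    ∀ {a b : Fin 6} → a ≢ b → ∃ λ l → l < v × On line l (toℕ a) × On line l (toℕ b)
  sixCliqueᵇ-sound names ok {a} {b} a≢b = collinearᵇ-sound names (fixed (toℕ a)) (fixed (toℕ b))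
    (everyPair-sound (λ a b → collinearᵇ names (fixed (toℕ a)) (fixed (toℕ b))) ok a≢b)

module Finite (v : ℕ) (lines : List (Fin 3 → ℕ)) (colours : List ℕ) where
  line : ℕ → Fin 3 → ℕ
  line = nth (λ _ → 0) lines

  colour : ℕ → ℕ
  colour = nth 0 colours

  reading : Reading line v
  reading = record
    { x = 0 ; bound = v ; bound+x≤v = ≤-reflexive (+-identityʳ v)
    ; content = λ l i → fixed (line (offset l) i)
    ; faithful = faithful ; faithful-sound = faithful-sound }
    where
    faithful : Expr → Bool
    faithful (fixed _) = true
    faithful (shifted _) = false
    faithful-sound : ∀ l → T (faithful l) → ∀ i → line (⟦ l ⟧ 0) i ≡ line (offset l) i
    faithful-sound (fixed l) _ i = refl

  open Checks reading

  names : List Expr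
  names = map fixed (upTo v)

  colour-apartᵇ : ℕ → Fin 3 → Fin 3 → Bool
  colour-apartᵇ l i j = apart (fixed (colour (line l i))) (fixed (colour (line l j)))

  coloursᵇ : Bool
  coloursᵇ = everyBelow v (λ p → colour p <ᵇ 6) ∧ everyBelow v (everyPair ∘ colour-apartᵇ)

  table : T (linesBelowᵇ v) → Table v
  table ok = record
    { line = line
    ; line< = proj₁ ∘ linesBelowᵇ-sound ok
    ; line-injective = proj₂ ∘ linesBelowᵇ-sound ok
    }

  certificate : (lines-ok : T (linesBelowᵇ v)) → T (starsBelowᵇ names v) →
    T (parentsBelowᵇ names v) → T coloursᵇ → Certificate (table lines-ok)
  certificate _ stars-ok parents-ok colours-ok = record
    { star = starsBelowᵇ-sound names stars-ok
    ; parent = parentsBelowᵇ-sound names parents-ok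
    ; colour = colour
    ; colour<6 = λ p<v → <ᵇ⇒< _ 6 (everyBelow-sound (λ p → colour p <ᵇ 6) colours<6 p<v)
    ; colour-proper = λ {l} l<v → injective-if-pairwise-≢ _ λ {i} {j} i≢j →
        apart-sound (fixed (colour (line l i))) (fixed (colour (line l j))) 0
          (everyPair-sound (colour-apartᵇ l)
            (everyBelow-sound (everyPair ∘ colour-apartᵇ) colours-apart l<v) i≢j)
    }
    where
    colours<6 : T (everyBelow v (λ p → colour p <ᵇ 6))
    colours<6 = proj₁ (∧-split (everyBelow v (λ p → colour p <ᵇ 6)) _ colours-ok)
    colours-apart : T (everyBelow v (everyPair ∘ colour-apartᵇ))
    colours-apart = proj₂ (∧-split (everyBelow v (λ p → colour p <ᵇ 6)) _ colours-ok)

  adjacentᵇ : ℕ → ℕ → Bool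
  adjacentᵇ p q = apart (fixed p) (fixed q) ∧ collinearᵇ names (fixed p) (fixed q)

  adjacentᵇ-sound : ∀ {p q} → T (adjacentᵇ p q) → p ≢ q × ∃ λ l → l < v × On line l p × On line l q
  adjacentᵇ-sound {p} {q} h with ∧-split (apart (fixed p) (fixed q)) _ h
  ... | p-apart-q , collinear = apart-sound (fixed p) (fixed q) 0 p-apart-q ,
                                collinearᵇ-sound names (fixed p) (fixed q) collinear

  -- Precomputed neighbour lists, checked once against the blocks, keep the search fast.
  adjacentIn : List (List ℕ) → ℕ → ℕ → Bool
  adjacentIn neighbours p q = (p <ᵇ v) ∧ any (q ≡ᵇ_) (nth [] neighbours p)

  neighboursᵇ : List (List ℕ) → Bool
  neighboursᵇ neighbours = everyBelow v (λ p → all (adjacentᵇ p) (nth [] neighbours p))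

  adjacentIn-sound : ∀ neighbours → T (neighboursᵇ neighbours) →
    ∀ {p q} → T (adjacentIn neighbours p q) → p ≢ q × ∃ λ l → l < v × On line l p × On line l q
  adjacentIn-sound neighbours ok {p} {q} h with ∧-split (p <ᵇ v) _ h
  ... | p<ᵇv , listed = adjacentᵇ-sound (All.lookup
    (all⁺ (adjacentᵇ p) (nth [] neighbours p) (everyBelow-sound _ ok (<ᵇ⇒< p v p<ᵇv)))
    (Any.map (≡ᵇ⇒≡ q _) (any⁻ (q ≡ᵇ_) (nth [] neighbours p) listed)))

  six-chromatic-by-clique : T (linesBelowᵇ v) → T (starsBelowᵇ names v) → T (parentsBelowᵇ names v) →
    T coloursᵇ → T (sixCliqueᵇ names) → 6 ≤ v → SixChromatic v
  six-chromatic-by-clique lines-ok stars-ok parents-ok colours-ok clique-ok 6≤v =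
    Certified.six-chromatic-by-clique (certificate lines-ok stars-ok parents-ok colours-ok) 6≤v
      (sixCliqueᵇ-sound names clique-ok)

  six-chromatic-by-search : T (linesBelowᵇ v) → T (starsBelowᵇ names v) → T (parentsBelowᵇ names v) →
    T coloursᵇ → (neighbours : List (List ℕ)) → T (neighboursᵇ neighbours) →
    (order : List ℕ) → T (not (Backtracking.extendable (adjacentIn neighbours) 5 [] order)) →
    SixChromatic v
  six-chromatic-by-search lines-ok stars-ok parents-ok colours-ok neighbours neighbours-ok =
    Certified.six-chromatic-by-search (certificate lines-ok stars-ok parents-ok colours-ok)
      (adjacentIn neighbours) (adjacentIn-sound neighbours neighbours-ok)

-- The family on 19 + m points

-- Blocks 0, …, 15 form the gadget and block 16 + i is {13 + i, 14 + i, 16 + i}.  The shifted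
-- points 16, 17 and 18 of the gadget stand for the last three points 16 + m, 17 + m, 18 + m
-- of the chain, and shifted c names the chain block c + x.
familyBlock : Expr → Fin 3 → Expr
familyBlock (fixed 0) = ⟨ fixed 0 , fixed 1 , fixed 2 ⟩
familyBlock (fixed 1) = ⟨ fixed 0 , fixed 3 , fixed 4 ⟩
familyBlock (fixed 2) = ⟨ fixed 1 , fixed 3 , fixed 5 ⟩
familyBlock (fixed 3) = ⟨ fixed 2 , fixed 4 , fixed 5 ⟩
familyBlock (fixed 4) = ⟨ fixed 0 , fixed 5 , fixed 6 ⟩
familyBlock (fixed 5) = ⟨ fixed 1 , fixed 4 , fixed 7 ⟩
familyBlock (fixed 6) = ⟨ fixed 2 , fixed 3 , fixed 8 ⟩
familyBlock (fixed 7) = ⟨ fixed 6 , fixed 7 , fixed 13 ⟩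
familyBlock (fixed 8) = ⟨ fixed 8 , fixed 9 , fixed 13 ⟩
familyBlock (fixed 9) = ⟨ fixed 8 , fixed 10 , fixed 14 ⟩
familyBlock (fixed 10) = ⟨ fixed 7 , fixed 12 , fixed 15 ⟩
familyBlock (fixed 11) = ⟨ fixed 9 , fixed 11 , shifted 17 ⟩
familyBlock (fixed 12) = ⟨ fixed 10 , fixed 12 , shifted 17 ⟩
familyBlock (fixed 13) = ⟨ fixed 9 , fixed 12 , shifted 18 ⟩
familyBlock (fixed 14) = ⟨ fixed 10 , fixed 11 , shifted 18 ⟩
familyBlock (fixed 15) = ⟨ fixed 6 , fixed 11 , shifted 16 ⟩
familyBlock (fixed c) = ⟨ fixed (c ∸ 3) , fixed (c ∸ 2) , fixed c ⟩
familyBlock (shifted c) = ⟨ shifted (c ∸ 3) , shifted (c ∸ 2) , shifted c ⟩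

mod4 : ℕ → ℕ
mod4 (suc (suc (suc (suc n)))) = mod4 n
mod4 n = n

mod4<4 : ∀ n → mod4 n < 4
mod4<4 0 = s≤s z≤n
mod4<4 1 = s≤s (s≤s z≤n)
mod4<4 2 = s≤s (s≤s (s≤s z≤n))
mod4<4 3 = s≤s (s≤s (s≤s (s≤s z≤n)))
mod4<4 (suc (suc (suc (suc n)))) = mod4<4 n

familyColour : ℕ → ℕ
familyColour 0 = 0
familyColour 1 = 2
familyColour 2 = 3
familyColour 3 = 5
familyColour 4 = 4
familyColour 5 = 1
familyColour 6 = 4
familyColour 7 = 1
familyColour 8 = 2
familyColour 9 = 4
familyColour 10 = 4
familyColour 11 = 5
familyColour 12 = 5
familyColour p = mod4 (p ∸ 13)

chain-colours : ∀ i → mod4 i ≢ mod4 (1 + i) × mod4 i ≢ mod4 (3 + i) × mod4 (1 + i) ≢ mod4 (3 + i)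
chain-colours 0 = (λ ()) , (λ ()) , (λ ())
chain-colours 1 = (λ ()) , (λ ()) , (λ ())
chain-colours 2 = (λ ()) , (λ ()) , (λ ())
chain-colours 3 = (λ ()) , (λ ()) , (λ ())
chain-colours (suc (suc (suc (suc i)))) = chain-colours i

chain-colour<4 : ∀ {p} → 13 ≤ p → familyColour p < 4
chain-colour<4 {p} 13≤p = subst (λ p → familyColour p < 4) (m+[n∸m]≡n 13≤p) (mod4<4 (p ∸ 13))

module Family (m : ℕ) where
  V : ℕ
  V = 19 + m

  line : ℕ → Fin 3 → ℕ
  line l i = ⟦ familyBlock (fixed l) i ⟧ m

  chain-faithful : ∀ c x → T (16 ≤ᵇ c) → ∀ i → line (c + x) i ≡ ⟦ familyBlock (shifted c) i ⟧ x
  chain-faithful c x 16≤c i = subst (λ c → line (c + x) i ≡ ⟦ familyBlock (shifted c) i ⟧ x)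
    (m+[n∸m]≡n (≤ᵇ⇒≤ 16 c 16≤c)) (from16 (c ∸ 16) i)
    where
    from16 : ∀ d i → line (16 + d + x) i ≡ ⟦ familyBlock (shifted (16 + d)) i ⟧ x
    from16 d zero = refl
    from16 d (suc zero) = refl
    from16 d (suc (suc zero)) = refl

  -- The gadget blocks name their shifted points with x = m in mind, so they are faithful only there.
  reading : (x bound : ℕ) → bound + x ≤ V → (atM : Bool) → (T atM → x ≡ m) → Reading line V
  reading x bound bound+x≤V atM atM⇒x≡m = record
    { x = x ; bound = bound ; bound+x≤v = bound+x≤V
    ; content = familyBlock ; faithful = faithful ; faithful-sound = faithful-sound }
    where
    faithful : Expr → Bool
    faithful (fixed _) = atM
    faithful (shifted c) = 16 ≤ᵇ c
    faithful-sound : ∀ l → T (faithful l) → ∀ i → line (⟦ l ⟧ x) i ≡ ⟦ familyBlock l i ⟧ x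
    faithful-sound (fixed c) h i rewrite atM⇒x≡m h = refl
    faithful-sound (shifted c) h i = chain-faithful c x h i

  -- The gadget and the last three points are read at x = m, chain block 16 + i at x = i, and an
  -- interior point 16 + k, which lies on the chain blocks 16 + k, 18 + k, 19 + k, at x = k.
  module AtM = Checks (reading m 19 ≤-refl true (λ _ → refl))
  module Chain {i} (i≤2+m : i ≤ 2 + m) = Checks (reading i 17 (+-monoʳ-≤ 17 i≤2+m) false (λ ()))
  module Interior {k} (k<m : k < m) = Checks (reading k 20 (+-monoʳ-≤ 19 k<m) false (λ ()))

  names : List Expr
  names = map fixed (upTo 19) ++ map shifted (16 ∷ 17 ∷ 18 ∷ [])

  data BlockKind : ℕ → Set where
    gadget : ∀ {l} → l < 16 → BlockKind l
    chain : ∀ {i} → i ≤ 2 + m → BlockKind (16 + i)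

  blockKind : ∀ {l} → l < V → BlockKind l
  blockKind {l} l<V with l <? 16
  ... | yes l<16 = gadget l<16
  ... | no l≮16 = subst BlockKind (m+[n∸m]≡n (≮⇒≥ l≮16)) (chain (≤-pred (∸-monoˡ-< l<V (≮⇒≥ l≮16))))

  data PointKind : ℕ → Set where
    gadget : ∀ {p} → p < 16 → PointKind p
    interior : ∀ {k} → k < m → PointKind (16 + k)
    end : ∀ {j} → j < 3 → PointKind (16 + j + m)

  pointKind : ∀ {p} → p < V → PointKind p
  pointKind {p} p<V with p <? 16
  ... | yes p<16 = gadget p<16
  ... | no p≮16 with p ∸ 16 <? m
  ...   | yes k<m = subst PointKind (m+[n∸m]≡n (≮⇒≥ p≮16)) (interior k<m)
  ...   | no k≮m = subst PointKind (trans (cong (16 +_) j+m≡k) (m+[n∸m]≡n (≮⇒≥ p≮16))) (end j<3)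
    where
    j+m≡k : p ∸ 16 ∸ m + m ≡ p ∸ 16
    j+m≡k = m∸n+n≡m (≮⇒≥ k≮m)
    j<3 : p ∸ 16 ∸ m < 3
    j<3 = +-cancelʳ-< m _ 3 (subst (_< 3 + m) (sym j+m≡k) (∸-monoˡ-< p<V (≮⇒≥ p≮16)))

  table : Table V
  table = record { line = line ; line< = line< ; line-injective = line-injective }
    where
    line< : ∀ {l} → l < V → ∀ i → line l i < V
    line< l<V with blockKind l<V
    ... | gadget l<16 = proj₁ (AtM.linesBelowᵇ-sound tt l<16)
    ... | chain i≤2+m = proj₁ (Chain.lineᵇ-sound i≤2+m (shifted 16) tt)
    line-injective : ∀ {l} → l < V → ∀ {i j} → line l i ≡ line l j → i ≡ j
    line-injective l<V with blockKind l<V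
    ... | gadget l<16 = proj₂ (AtM.linesBelowᵇ-sound tt l<16)
    ... | chain i≤2+m = proj₂ (Chain.lineᵇ-sound i≤2+m (shifted 16) tt)

  star : ∀ {p} → p < V → StarAt line V p
  star p<V with pointKind p<V
  ... | gadget p<16 = AtM.starsBelowᵇ-sound names tt p<16
  ... | interior k<m = Interior.starAmongᵇ-sound k<m (map shifted (16 ∷ 18 ∷ 19 ∷ [])) (shifted 16) tt
  ... | end {j} j<3 = AtM.starAmongᵇ-sound names (shifted (16 + j))
                        (everyBelow-sound (λ j → AtM.starAmongᵇ names (shifted (16 + j))) tt j<3)

  parent : ∀ {p} → p < V → 0 < p → HasParent line V p
  parent p<V 0<p with pointKind p<V
  ... | gadget p<16 = AtM.parentsBelowᵇ-sound names tt p<16 0<p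
  ... | interior k<m = Interior.parentᵇ-sound k<m (shifted 18 ∷ []) (shifted 16) tt
  ... | end {j} j<3 = AtM.parentᵇ-sound names (shifted (16 + j))
                        (everyBelow-sound (λ j → AtM.parentᵇ names (shifted (16 + j))) tt j<3)

  -- A shifted point of the gadget lies on the chain, whose colours are below 4, while its two
  -- companions in a gadget block have colours 4 and 5.
  colour-apartᵇ : Expr → Expr → Bool
  colour-apartᵇ (fixed a) (fixed b) = apart (fixed (familyColour a)) (fixed (familyColour b))
  colour-apartᵇ (fixed a) (shifted c) = (4 ≤ᵇ familyColour a) ∧ (13 ≤ᵇ c)
  colour-apartᵇ (shifted c) (fixed a) = (4 ≤ᵇ familyColour a) ∧ (13 ≤ᵇ c)
  colour-apartᵇ (shifted _) (shifted _) = false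

  colour-apartᵇ-sound : ∀ e e′ → T (colour-apartᵇ e e′) →
    familyColour (⟦ e ⟧ m) ≢ familyColour (⟦ e′ ⟧ m)
  colour-apartᵇ-sound (fixed a) (fixed b) =
    apart-sound (fixed (familyColour a)) (fixed (familyColour b)) 0
  colour-apartᵇ-sound (fixed a) (shifted c) h with ∧-split (4 ≤ᵇ familyColour a) (13 ≤ᵇ c) h
  ... | 4≤colour , 13≤c = λ e → <⇒≱ (chain-colour<4 (≤-trans (≤ᵇ⇒≤ 13 c 13≤c) (m≤m+n c m)))
                                      (subst (4 ≤_) e (≤ᵇ⇒≤ 4 _ 4≤colour))
  colour-apartᵇ-sound (shifted c) (fixed a) h = ≢-sym (colour-apartᵇ-sound (fixed a) (shifted c) h)

  gadget-colours-apartᵇ : ℕ → Fin 3 → Fin 3 → Bool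
  gadget-colours-apartᵇ l i j = colour-apartᵇ (familyBlock (fixed l) i) (familyBlock (fixed l) j)

  colour-proper : ∀ {l} → l < V → ∀ {i j} → familyColour (line l i) ≡ familyColour (line l j) → i ≡ j
  colour-proper {l} l<V with blockKind l<V
  ... | gadget l<16 = injective-if-pairwise-≢ _ λ {i} {j} i≢j →
          colour-apartᵇ-sound (familyBlock (fixed l) i) (familyBlock (fixed l) j)
            (everyPair-sound (gadget-colours-apartᵇ l)
              (everyBelow-sound (everyPair ∘ gadget-colours-apartᵇ) tt l<16) i≢j)
  ... | chain {i} _ with chain-colours i
  ...   | c₀≢c₁ , c₀≢c₂ , c₁≢c₂ = injective-if-pairwise-≢ _ (pairwise-≢-on-Fin3 _ c₀≢c₁ c₀≢c₂ c₁≢c₂)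

  colour<6 : ∀ p → familyColour p < 6
  colour<6 p with p <? 13
  ... | yes p<13 = <ᵇ⇒< _ 6 (everyBelow-sound (λ p → familyColour p <ᵇ 6) tt p<13)
  ... | no p≮13 = ≤-trans (chain-colour<4 (≮⇒≥ p≮13)) (m≤m+n 4 2)

  certificate : Certificate table
  certificate = record
    { star = star ; parent = parent ; colour = familyColour
    ; colour<6 = λ {p} _ → colour<6 p ; colour-proper = colour-proper }

family : ∀ m → SixChromatic (19 + m)
family m = Certified.six-chromatic-by-clique (Family.certificate m) (m≤m+n 6 (13 + m))
  (Family.AtM.sixCliqueᵇ-sound m (Family.names m) tt)

-- The configurations on 11 and on 13, …, 18 points

cliqueBlocks : List (Fin 3 → ℕ)
cliqueBlocks = ⟨ 0 , 1 , 2 ⟩ ∷ ⟨ 0 , 3 , 4 ⟩ ∷ ⟨ 1 , 3 , 5 ⟩ ∷ ⟨ 2 , 4 , 5 ⟩ ∷ ⟨ 0 , 5 , 6 ⟩ ∷ ⟨ 1 , 4 , 7 ⟩ ∷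
               ⟨ 2 , 3 , 8 ⟩ ∷ []

module V13 = Finite 13
  (cliqueBlocks ++
   ⟨ 7 , 9 , 10 ⟩ ∷ ⟨ 7 , 11 , 12 ⟩ ∷ ⟨ 10 , 8 , 12 ⟩ ∷ ⟨ 8 , 9 , 11 ⟩ ∷ ⟨ 12 , 6 , 9 ⟩ ∷ ⟨ 10 , 6 , 11 ⟩ ∷ [])
  (0 ∷ 1 ∷ 2 ∷ 3 ∷ 4 ∷ 5 ∷ 1 ∷ 0 ∷ 0 ∷ 2 ∷ 3 ∷ 4 ∷ 5 ∷ [])

module V14 = Finite 14
  (cliqueBlocks ++
   ⟨ 8 , 10 , 12 ⟩ ∷ ⟨ 8 , 7 , 13 ⟩ ∷ ⟨ 7 , 9 , 11 ⟩ ∷ ⟨ 11 , 13 , 10 ⟩ ∷ ⟨ 10 , 6 , 9 ⟩ ∷ ⟨ 6 , 11 , 12 ⟩ ∷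
   ⟨ 13 , 9 , 12 ⟩ ∷ [])
  (0 ∷ 1 ∷ 2 ∷ 3 ∷ 4 ∷ 5 ∷ 1 ∷ 0 ∷ 1 ∷ 2 ∷ 0 ∷ 3 ∷ 4 ∷ 5 ∷ [])

module V15 = Finite 15
  (cliqueBlocks ++
   ⟨ 7 , 9 , 11 ⟩ ∷ ⟨ 7 , 13 , 10 ⟩ ∷ ⟨ 13 , 8 , 12 ⟩ ∷ ⟨ 8 , 14 , 9 ⟩ ∷ ⟨ 13 , 14 , 11 ⟩ ∷ ⟨ 14 , 10 , 12 ⟩ ∷
   ⟨ 10 , 6 , 9 ⟩ ∷ ⟨ 6 , 11 , 12 ⟩ ∷ [])
  (0 ∷ 1 ∷ 2 ∷ 3 ∷ 4 ∷ 5 ∷ 1 ∷ 0 ∷ 0 ∷ 2 ∷ 3 ∷ 3 ∷ 2 ∷ 1 ∷ 4 ∷ [])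

module V16 = Finite 16
  (cliqueBlocks ++
   ⟨ 7 , 12 , 13 ⟩ ∷ ⟨ 7 , 9 , 14 ⟩ ∷ ⟨ 8 , 15 , 9 ⟩ ∷ ⟨ 8 , 6 , 11 ⟩ ∷ ⟨ 9 , 6 , 10 ⟩ ∷ ⟨ 13 , 15 , 10 ⟩ ∷
   ⟨ 13 , 14 , 11 ⟩ ∷ ⟨ 11 , 12 , 15 ⟩ ∷ ⟨ 12 , 14 , 10 ⟩ ∷ [])
  (0 ∷ 1 ∷ 2 ∷ 3 ∷ 4 ∷ 5 ∷ 1 ∷ 0 ∷ 0 ∷ 2 ∷ 0 ∷ 2 ∷ 1 ∷ 3 ∷ 4 ∷ 4 ∷ [])

module V17 = Finite 17
  (cliqueBlocks ++
   ⟨ 6 , 9 , 11 ⟩ ∷ ⟨ 6 , 7 , 10 ⟩ ∷ ⟨ 7 , 12 , 13 ⟩ ∷ ⟨ 12 , 9 , 10 ⟩ ∷ ⟨ 12 , 16 , 15 ⟩ ∷ ⟨ 9 , 16 , 14 ⟩ ∷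
   ⟨ 10 , 8 , 15 ⟩ ∷ ⟨ 15 , 14 , 11 ⟩ ∷ ⟨ 14 , 8 , 13 ⟩ ∷ ⟨ 11 , 16 , 13 ⟩ ∷ [])
  (0 ∷ 1 ∷ 2 ∷ 3 ∷ 4 ∷ 5 ∷ 1 ∷ 0 ∷ 0 ∷ 0 ∷ 2 ∷ 2 ∷ 1 ∷ 3 ∷ 1 ∷ 3 ∷ 4 ∷ [])

module V18 = Finite 18
  (cliqueBlocks ++
   ⟨ 6 , 7 , 8 ⟩ ∷ ⟨ 8 , 13 , 14 ⟩ ∷ ⟨ 6 , 9 , 10 ⟩ ∷ ⟨ 7 , 11 , 12 ⟩ ∷ ⟨ 13 , 11 , 16 ⟩ ∷ ⟨ 13 , 12 , 15 ⟩ ∷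
   ⟨ 11 , 10 , 17 ⟩ ∷ ⟨ 10 , 15 , 16 ⟩ ∷ ⟨ 16 , 9 , 17 ⟩ ∷ ⟨ 9 , 15 , 14 ⟩ ∷ ⟨ 14 , 12 , 17 ⟩ ∷ [])
  (0 ∷ 1 ∷ 2 ∷ 3 ∷ 4 ∷ 5 ∷ 1 ∷ 0 ∷ 4 ∷ 0 ∷ 2 ∷ 1 ∷ 2 ∷ 0 ∷ 1 ∷ 3 ∷ 4 ∷ 3 ∷ [])

from-thirteen : ∀ d → SixChromatic (13 + d)
from-thirteen 0 = V13.six-chromatic-by-clique tt tt tt tt tt (m≤m+n 6 7)
from-thirteen 1 = V14.six-chromatic-by-clique tt tt tt tt tt (m≤m+n 6 8)
from-thirteen 2 = V15.six-chromatic-by-clique tt tt tt tt tt (m≤m+n 6 9)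
from-thirteen 3 = V16.six-chromatic-by-clique tt tt tt tt tt (m≤m+n 6 10)
from-thirteen 4 = V17.six-chromatic-by-clique tt tt tt tt tt (m≤m+n 6 11)
from-thirteen 5 = V18.six-chromatic-by-clique tt tt tt tt tt (m≤m+n 6 12)
from-thirteen (suc (suc (suc (suc (suc (suc m)))))) = family m

module V11 = Finite 11
  (⟨ 3 , 8 , 7 ⟩ ∷ ⟨ 8 , 10 , 6 ⟩ ∷ ⟨ 8 , 2 , 9 ⟩ ∷ ⟨ 6 , 9 , 4 ⟩ ∷ ⟨ 6 , 0 , 2 ⟩ ∷ ⟨ 9 , 10 , 7 ⟩ ∷
   ⟨ 2 , 1 , 4 ⟩ ∷ ⟨ 4 , 0 , 5 ⟩ ∷ ⟨ 0 , 1 , 3 ⟩ ∷ ⟨ 10 , 3 , 5 ⟩ ∷ ⟨ 5 , 1 , 7 ⟩ ∷ [])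
  (0 ∷ 1 ∷ 2 ∷ 2 ∷ 3 ∷ 4 ∷ 1 ∷ 0 ∷ 3 ∷ 4 ∷ 5 ∷ [])

eleven : SixChromatic 11
eleven = V11.six-chromatic-by-search tt tt tt tt neighbours tt
  (4 ∷ 1 ∷ 0 ∷ 5 ∷ 3 ∷ 2 ∷ 6 ∷ 9 ∷ 7 ∷ 10 ∷ 8 ∷ []) tt
  where
  neighbours : List (List ℕ)
  neighbours =
    (1 ∷ 2 ∷ 3 ∷ 4 ∷ 5 ∷ 6 ∷ []) ∷ (0 ∷ 2 ∷ 3 ∷ 4 ∷ 5 ∷ 7 ∷ []) ∷ (0 ∷ 1 ∷ 4 ∷ 6 ∷ 8 ∷ 9 ∷ []) ∷
    (0 ∷ 1 ∷ 5 ∷ 7 ∷ 8 ∷ 10 ∷ []) ∷ (0 ∷ 1 ∷ 2 ∷ 5 ∷ 6 ∷ 9 ∷ []) ∷ (0 ∷ 1 ∷ 3 ∷ 4 ∷ 7 ∷ 10 ∷ []) ∷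
    (0 ∷ 2 ∷ 4 ∷ 8 ∷ 9 ∷ 10 ∷ []) ∷ (1 ∷ 3 ∷ 5 ∷ 8 ∷ 9 ∷ 10 ∷ []) ∷ (2 ∷ 3 ∷ 6 ∷ 7 ∷ 9 ∷ 10 ∷ []) ∷
    (2 ∷ 4 ∷ 6 ∷ 7 ∷ 8 ∷ 10 ∷ []) ∷ (3 ∷ 5 ∷ 6 ∷ 7 ∷ 8 ∷ 9 ∷ []) ∷ []

theorem24 : (v : ℕ) → (v ≡ 11 ⊎ 13 ≤ v) →
    Σ (Config v) (λ C → Connected C × StrongChromaticNumber≡ C 6)
theorem24 .11 (inj₁ refl) = eleven
theorem24 v (inj₂ 13≤v) = subst SixChromatic (m+[n∸m]≡n 13≤v) (from-thirteen (v ∸ 13))
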